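{- Let $G=(V,E)$ be a finite, undirected, unweighted, 2-vertex-connected graph with $n=|V|$ vertices, equipped with its shortest-path (graph) metric. Suppose $T$ is a minimum spanning tree of $G$ (in an unweighted graph, any spanning tree) and $C_T$ is a simple cycle in $G$ whose vertex set contains every vertex that has odd degree in $T$. Then $G$ has a TSP tour of length at most $4n/3$, and such a tour can be constructed from $T$ and $C_T$.
   Context: A TSP tour of $G$ is a closed walk in $G$ that visits every vertex of $V$ at least once; its length is the number of edges traversed, counted with multiplicity (equivalently, the length of a tour in the shortest-path metric of $G$). The simple cycle $C_T$ may contain arbitrarily many vertices that have even degree in $T$. -}

module Defs where

open import Data.Nat using (ℕ; zero; suc; _+_; _*_; _≤_; _%_)
open import Data.Fin using (Fin)
open import Data.Bool using (Bool; true; false; if_then_else_)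
open import Data.List using (List; []; _∷_; map; allFin)
open import Data.Nat.ListAction using (sum)
open import Data.List.Membership.Propositional using (_∈_; _∉_)
open import Data.List.Relation.Unary.Unique.Propositional using (Unique)
open import Data.Product using (Σ; _×_; ∃)
open import Relation.Binary.PropositionalEquality using (_≡_; _≢_)
open import Relation.Nullary using (¬_)

record Graph (n : ℕ) : Set where
  field
    adj    : Fin n → Fin n → Bool
    sym    : ∀ u v → adj u v ≡ adj v u
    irrefl : ∀ v → adj v v ≡ false
open Graph public

Edge : ∀ {n} → Graph n → Fin n → Fin n → Set
Edge G u v = adj G u v ≡ true

data Walk {n : ℕ} (G : Graph n) : Fin n → Fin n → Set where
  []  : ∀ {u} → Walk G u u
  _∷_ : ∀ {u v w} → Edge G u v → Walk G v w → Walk G u w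

len : ∀ {n} {G : Graph n} {u w} → Walk G u w → ℕ
len []      = 0
len (_ ∷ p) = suc (len p)

-- Vertices visited by a walk u → w, in order, omitting the final vertex w
-- (for a closed walk this lists each position of the cyclic sequence once).
inner : ∀ {n} {G : Graph n} {u w} → Walk G u w → List (Fin n)
inner []                = []
inner (_∷_ {u} _ p)     = u ∷ inner p

verts : ∀ {n} {G : Graph n} {u w} → Walk G u w → List (Fin n)
verts {w = w} p = Data.List._++_ (inner p) (w ∷ [])

Connected : ∀ {n} → Graph n → Set
Connected G = ∀ u v → Walk G u v

ConnectedWithout : ∀ {n} → Graph n → Fin n → Set
ConnectedWithout G x =
  ∀ u v → u ≢ x → v ≢ x → Σ (Walk G u v) (λ p → x ∉ verts p)

TwoVertexConnected : ∀ {n} → Graph n → Set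
TwoVertexConnected {n} G = (3 ≤ n) × Connected G × (∀ x → ConnectedWithout G x)

SimpleCycle : ∀ {n} (G : Graph n) {v : Fin n} → Walk G v v → Set
SimpleCycle G c = (3 ≤ len c) × Unique (inner c)

HasCycle : ∀ {n} → Graph n → Set
HasCycle G = ∃ λ v → Σ (Walk G v v) (SimpleCycle G)

Subgraph : ∀ {n} → Graph n → Graph n → Set
Subgraph T G = ∀ u v → Edge T u v → Edge G u v

SpanningTree : ∀ {n} → Graph n → Graph n → Set
SpanningTree G T = Subgraph T G × Connected T × ¬ HasCycle T

deg : ∀ {n} → Graph n → Fin n → ℕ
deg {n} G v = sum (map (λ u → if adj G v u then 1 else 0) (allFin n))

OddDegree : ∀ {n} → Graph n → Fin n → Set
OddDegree G v = deg G v % 2 ≡ 1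

TSPTour : ∀ {n} (G : Graph n) {s : Fin n} → Walk G s s → Set
TSPTour {n} G t = ∀ (x : Fin n) → x ∈ verts t

-- If the cycle C is long (2n ≤ 3|C|), C is completed to a tour by detours: every vertex off C costs at
-- most two edges, so the tour has length at most |C| + 2(n − |C|) ≤ 4n/3. Otherwise the edges of C fall into
-- two classes that swap at the odd-degree vertices of T, and each class is a join for those vertices.
-- Adding the lighter class, of at most |C|/2 edges, to T makes every degree even, and an Euler tour of the
-- result has length at most n − 1 + |C|/2 < 4n/3. The Euler tour is built by removing leaves of T one at a
-- time, joining the walks of the class in pairs at each removed leaf.

module Submission where

open import Defs hiding (sym)
open import Data.Nat.Properties hiding (_≟_)
open import Algebra.Properties.CommutativeSemigroup +-commutativeSemigroup using (x∙yz≈y∙xz; x∙yz≈yx∙z)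
open import Data.Bool as Bool using (Bool; true; false; _∧_; if_then_else_)
open import Data.Bool.Properties using (¬-not)
open import Data.Empty using (⊥-elim)
open import Data.Fin using (Fin; zero; suc)
open import Data.Fin.Properties using (_≟_; any?)
open import Data.List using (List; []; _∷_; _++_; length; map; tabulate; allFin)
open import Data.List.Properties using (map-++; map-tabulate)
open import Data.List.Membership.Propositional using (_∈_; _∉_)
open import Data.List.Membership.Propositional.Properties using (∈-++⁺ˡ; ∈-++⁺ʳ; ∈-++⁻)
open import Data.List.Relation.Unary.All as All using (All; []; _∷_)
open import Data.List.Relation.Unary.All.Properties using (All¬⇒¬Any; ¬Any⇒All¬)
  renaming (++⁺ to All-++⁺; ++⁻ to All-++⁻)
open import Data.List.Relation.Unary.Any using (Any; here; there)
open import Data.List.Relation.Unary.Any.Properties using () renaming (++⁺ˡ to Any-++⁺ˡ; ++⁺ʳ to Any-++⁺ʳ)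
open import Data.List.Relation.Unary.Unique.Propositional using (Unique; []; _∷_)
open import Data.List.Relation.Unary.Unique.Propositional.Properties using (Unique[x∷xs]⇒x∉xs)
open import Data.Nat using (ℕ; zero; suc; parity; _%_; _≤?_; _+_; _*_; _∸_; _≤_; _<_; z≤n; s≤s)
open import Data.Nat.DivMod using ([m+n]%n≡m%n)
open import Data.Nat.Induction using (<-wellFounded)
open import Data.Nat.ListAction using (sum)
open import Data.Nat.ListAction.Properties using (sum-++)
open import Data.Nat.Tactic.RingSolver using (solve-∀)
open import Data.Parity using (Parity; 0ℙ; 1ℙ)
import Data.Parity as ℙ
open import Data.Parity.Properties using (+-homo-+; *-homo-*; p+p≡0ℙ) renaming (_≟_ to _ℙ≟_)
open import Data.Product as Product using (Σ; _×_; ∃; _,_; proj₁; proj₂)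
open import Data.Sum as Sum using (_⊎_; inj₁; inj₂)
open import Function using (id; _∘_; case_of_)
open import Induction.WellFounded using (Acc; acc)
open import Relation.Nullary using (does; yes; no; ¬_; contradiction)
open import Relation.Nullary.Decidable using (dec-true; dec-false; _×-dec_; ¬?; decidable-stable)
open import Relation.Binary.PropositionalEquality
  using (_≡_; _≢_; refl; sym; trans; cong; cong₂; subst; module ≡-Reasoning)

parity-2*+ : ∀ a b → parity (2 * a + b) ≡ parity b
parity-2*+ a b = trans (+-homo-+ (2 * a) b) (cong (ℙ._+ parity b) (*-homo-* 2 a))

parity≡1ℙ⇒%2≡1 : ∀ m → parity m ≡ 1ℙ → m % 2 ≡ 1
parity≡1ℙ⇒%2≡1 1             _   = refl
parity≡1ℙ⇒%2≡1 (suc (suc m)) odd =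
  trans (cong (_% 2) (+-comm 2 m)) (trans ([m+n]%n≡m%n m 2) (parity≡1ℙ⇒%2≡1 m odd))

2*m≤m+n⊎2*n≤m+n : ∀ m n → 2 * m ≤ m + n ⊎ 2 * n ≤ m + n
2*m≤m+n⊎2*n≤m+n m n with ≤-total m n
... | inj₁ m≤n = inj₁ (subst (_≤ m + n) (cong (m +_) (sym (+-identityʳ m))) (+-monoʳ-≤ m m≤n))
... | inj₂ n≤m = inj₂ (subst (_≤ m + n) (cong (n +_) (sym (+-identityʳ n))) (+-monoˡ-≤ n n≤m))

toℕ : Bool → ℕ
toℕ b = if b then 1 else 0

count : ∀ {n} → (Fin n → Bool) → ℕ
count {zero}  P = 0
count {suc n} P = toℕ (P zero) + count (P ∘ suc)

infixl 6 _∖_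
_∖_ : ∀ {n} → (Fin n → Bool) → Fin n → Fin n → Bool
(P ∖ l) x = if does (x ≟ l) then false else P x

∖-intro : ∀ {n} {P : Fin n → Bool} {l x : Fin n} → P x ≡ true → x ≢ l → (P ∖ l) x ≡ true
∖-intro {l = l} {x} Px x≢l with x ≟ l
... | yes x≡l = contradiction x≡l x≢l
... | no  _   = Px

∖-elim : ∀ {n} {P : Fin n → Bool} {l x : Fin n} → (P ∖ l) x ≡ true → P x ≡ true × x ≢ l
∖-elim {l = l} {x} P∖lx with x ≟ l
... | no x≢l = P∖lx , x≢l

count-false : ∀ n → count {n} (λ _ → false) ≡ 0
count-false zero    = refl
count-false (suc n) = count-false n

count-true : ∀ n → count {n} (λ _ → true) ≡ n
count-true zero    = refl
count-true (suc n) = cong suc (count-true n)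

count-cong : ∀ {n} {P Q : Fin n → Bool} → (∀ x → P x ≡ Q x) → count P ≡ count Q
count-cong {zero}  P≗Q = refl
count-cong {suc n} P≗Q = cong₂ _+_ (cong toℕ (P≗Q zero)) (count-cong (P≗Q ∘ suc))

count≤n : ∀ {n} (P : Fin n → Bool) → count P ≤ n
count≤n {zero}  P = z≤n
count≤n {suc n} P with P zero
... | true  = s≤s (count≤n (P ∘ suc))
... | false = m≤n⇒m≤1+n (count≤n (P ∘ suc))

count-mono : ∀ {n} {P Q : Fin n → Bool} → (∀ x → P x ≡ true → Q x ≡ true) → count P ≤ count Q
count-mono {zero}          P⊆Q = z≤n
count-mono {suc n} {P} {Q} P⊆Q with P zero in p₀ | Q zero in q₀
... | true  | true  = s≤s (count-mono (P⊆Q ∘ suc))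
... | true  | false with () ← trans (sym q₀) (P⊆Q zero p₀)
... | false | true  = m≤n⇒m≤1+n (count-mono (P⊆Q ∘ suc))
... | false | false = count-mono (P⊆Q ∘ suc)

count-∖ : ∀ {n} (P : Fin n → Bool) (l : Fin n) → count P ≡ toℕ (P l) + count (P ∖ l)
count-∖ {suc n} P zero    = refl
count-∖ {suc n} P (suc l) =
  trans (cong (toℕ (P zero) +_) (count-∖ (P ∘ suc) l)) (x∙yz≈y∙xz (toℕ (P zero)) (toℕ (P (suc l))) _)

count-∖-∈ : ∀ {n} (P : Fin n → Bool) {l : Fin n} → P l ≡ true → count P ≡ suc (count (P ∖ l))
count-∖-∈ P {l} Pl = trans (count-∖ P l) (cong (λ b → toℕ b + count (P ∖ l)) Pl)

0<count : ∀ {n} (P : Fin n → Bool) {l : Fin n} → P l ≡ true → 0 < count P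
0<count P Pl = subst (0 <_) (sym (count-∖-∈ P Pl)) (s≤s z≤n)

count-< : ∀ {n} {P Q : Fin n → Bool} {l : Fin n} → (∀ x → P x ≡ true → Q x ≡ true) →
          P l ≡ false → Q l ≡ true → count P < count Q
count-< {P = P} {Q} {l} P⊆Q Pl Ql = subst (count P <_) (sym (count-∖-∈ Q Ql)) (s≤s (count-mono P⊆Q∖l))
  where
  P⊆Q∖l : ∀ x → P x ≡ true → (Q ∖ l) x ≡ true
  P⊆Q∖l x Px = ∖-intro {P = Q} (P⊆Q x Px) λ { refl → case trans (sym Pl) Px of λ () }

δ : ∀ {n} → Fin n → Fin n → ℕ
δ a x = toℕ (does (a ≟ x))

δ-refl : ∀ {n} (a : Fin n) → δ a a ≡ 1
δ-refl a = cong toℕ (dec-true (a ≟ a) refl)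

δ-≢ : ∀ {n} {a x : Fin n} → a ≢ x → δ a x ≡ 0
δ-≢ {a = a} {x} a≢x = cong toℕ (dec-false (a ≟ x) a≢x)

deg≡count : ∀ {n} (G : Graph n) x → deg G x ≡ count (adj G x)
deg≡count G x = sum-allFin (adj G x)
  where
  sum-allFin : ∀ {n} (P : Fin n → Bool) → sum (map (toℕ ∘ P) (allFin n)) ≡ count P
  sum-allFin {zero}  P = refl
  sum-allFin {suc n} P = cong (toℕ (P zero) +_) (begin
    sum (map (toℕ ∘ P) (tabulate suc))       ≡⟨ cong sum (map-tabulate suc (toℕ ∘ P)) ⟩
    sum (tabulate (toℕ ∘ P ∘ suc))           ≡⟨ cong sum (map-tabulate id (toℕ ∘ P ∘ suc)) ⟨
    sum (map (toℕ ∘ P ∘ suc) (allFin n))     ≡⟨ sum-allFin (P ∘ suc) ⟩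
    count (P ∘ suc)                          ∎)
    where open ≡-Reasoning

module _ {n : ℕ} where
  open import Data.List.Membership.DecPropositional (_≟_ {n}) public using (_∈?_)

_∈ᵇ_ : ∀ {n} → Fin n → List (Fin n) → Bool
x ∈ᵇ xs = does (x ∈? xs)

∈⇒∈ᵇ : ∀ {n} {x : Fin n} {xs} → x ∈ xs → x ∈ᵇ xs ≡ true
∈⇒∈ᵇ = dec-true (_ ∈? _)

∉⇒∈ᵇ≡false : ∀ {n} {x : Fin n} {xs} → x ∉ xs → x ∈ᵇ xs ≡ false
∉⇒∈ᵇ≡false = dec-false (_ ∈? _)

∈ᵇ⇒∈ : ∀ {n} {x : Fin n} xs → x ∈ᵇ xs ≡ true → x ∈ xs
∈ᵇ⇒∈ {x = x} xs with x ∈? xs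
... | yes x∈ = λ _ → x∈
... | no  _  = λ ()

∈ᵇ-mono : ∀ {n} {xs ys : List (Fin n)} → (∀ {x} → x ∈ xs → x ∈ ys) →
          ∀ x → x ∈ᵇ xs ≡ true → x ∈ᵇ ys ≡ true
∈ᵇ-mono {xs = xs} xs⊆ys x = ∈⇒∈ᵇ ∘ xs⊆ys ∘ ∈ᵇ⇒∈ xs

length≤count-∈ᵇ : ∀ {n} {xs : List (Fin n)} → Unique xs → length xs ≤ count (_∈ᵇ xs)
length≤count-∈ᵇ {xs = []}     []           = z≤n
length≤count-∈ᵇ {xs = y ∷ ys} (y∉ys ∷ !ys) =
  ≤-trans (s≤s (length≤count-∈ᵇ !ys))
          (count-< {P = _∈ᵇ ys} {_∈ᵇ (y ∷ ys)} {y} (∈ᵇ-mono {xs = ys} there)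
                   (∉⇒∈ᵇ≡false {xs = ys} (All¬⇒¬Any y∉ys)) (∈⇒∈ᵇ {xs = y ∷ ys} (here refl)))

Unique[xs++y∷ys]⇒Unique[y∷xs] : ∀ {A : Set} (xs : List A) {y ys} → Unique (xs ++ y ∷ ys) → Unique (y ∷ xs)
Unique[xs++y∷ys]⇒Unique[y∷xs] []       _            = [] ∷ []
Unique[xs++y∷ys]⇒Unique[y∷xs] (x ∷ xs) (x≢ ∷ !xs++) with x≢xs , x≢y ∷ _ ← All-++⁻ xs x≢
                                                    | y≢xs ∷ !xs ← Unique[xs++y∷ys]⇒Unique[y∷xs] xs !xs++ =
  ((x≢y ∘ sym) ∷ y≢xs) ∷ x≢xs ∷ !xs

Unique⇒length≤n : ∀ {n} {xs : List (Fin n)} → Unique xs → length xs ≤ n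
Unique⇒length≤n !xs = ≤-trans (length≤count-∈ᵇ !xs) (count≤n _)

Edge-sym : ∀ {n} (G : Graph n) {u v} → Edge G u v → Edge G v u
Edge-sym G {u} {v} e = trans (Graph.sym G v u) e

Edge⇒≢ : ∀ {n} (G : Graph n) {u v} → Edge G u v → u ≢ v
Edge⇒≢ G {u} e refl with () ← trans (sym (irrefl G u)) e

module _ {n : ℕ} {G : Graph n} where


  infixr 5 _◅◅_
  _◅◅_ : ∀ {a b c} → Walk G a b → Walk G b c → Walk G a c
  []      ◅◅ q = q
  (e ∷ p) ◅◅ q = e ∷ (p ◅◅ q)

  len-◅◅ : ∀ {a b c} (p : Walk G a b) (q : Walk G b c) → len (p ◅◅ q) ≡ len p + len q
  len-◅◅ []      q = refl
  len-◅◅ (e ∷ p) q = cong suc (len-◅◅ p q)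

  verts-◅◅ : ∀ {a b c} (p : Walk G a b) (q : Walk G b c) → verts (p ◅◅ q) ≡ inner p ++ verts q
  verts-◅◅ []      q = refl
  verts-◅◅ (e ∷ p) q = cong (_ ∷_) (verts-◅◅ p q)

  start∈verts : ∀ {a b} (p : Walk G a b) → a ∈ verts p
  start∈verts []      = here refl
  start∈verts (e ∷ p) = here refl

  end∈verts : ∀ {a b} (p : Walk G a b) → b ∈ verts p
  end∈verts []      = here refl
  end∈verts (e ∷ p) = there (end∈verts p)

  inner⊆verts : ∀ {a b x} (p : Walk G a b) → x ∈ inner p → x ∈ verts p
  inner⊆verts p = ∈-++⁺ˡ

  ∈verts-◅◅⁺ˡ : ∀ {a b c x} (p : Walk G a b) (q : Walk G b c) → x ∈ verts p → x ∈ verts (p ◅◅ q)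
  ∈verts-◅◅⁺ˡ []      q (here refl) = start∈verts q
  ∈verts-◅◅⁺ˡ (e ∷ p) q (here refl) = here refl
  ∈verts-◅◅⁺ˡ (e ∷ p) q (there x∈) = there (∈verts-◅◅⁺ˡ p q x∈)

  ∈verts-◅◅⁺ʳ : ∀ {a b c x} (p : Walk G a b) (q : Walk G b c) → x ∈ verts q → x ∈ verts (p ◅◅ q)
  ∈verts-◅◅⁺ʳ p q x∈ = subst (_ ∈_) (sym (verts-◅◅ p q)) (∈-++⁺ʳ (inner p) x∈)

  ∈verts-◅◅⁻ : ∀ {a b c x} (p : Walk G a b) (q : Walk G b c) →
               x ∈ verts (p ◅◅ q) → x ∈ verts p ⊎ x ∈ verts q
  ∈verts-◅◅⁻ p q x∈ = Sum.map₁ (inner⊆verts p) (∈-++⁻ (inner p) (subst (_ ∈_) (verts-◅◅ p q) x∈))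

  verts-∷ : ∀ {a b} (p : Walk G a b) → ∃ λ xs → verts p ≡ a ∷ xs
  verts-∷ []      = [] , refl
  verts-∷ (e ∷ p) = verts p , refl

  0<len : ∀ {a b} → a ≢ b → (p : Walk G a b) → 0 < len p
  0<len a≢b []      = contradiction refl a≢b
  0<len a≢b (e ∷ p) = s≤s z≤n

  ∉verts : ∀ {a b x} (p : Walk G a b) → x ∉ inner p → x ≢ b → x ∉ verts p
  ∉verts p x∉p x≢b x∈p with ∈-++⁻ (inner p) x∈p
  ... | inj₁ x∈inner    = x∉p x∈inner
  ... | inj₂ (here x≡b) = x≢b x≡b

  length-inner : ∀ {a b} (p : Walk G a b) → length (inner p) ≡ len p
  length-inner []      = refl
  length-inner (e ∷ p) = cong suc (length-inner p)


  reverse : ∀ {a b} → Walk G a b → Walk G b a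
  reverse []      = []
  reverse (e ∷ p) = reverse p ◅◅ (Edge-sym G e ∷ [])

  len-reverse : ∀ {a b} (p : Walk G a b) → len (reverse p) ≡ len p
  len-reverse []      = refl
  len-reverse (e ∷ p) = trans (len-◅◅ (reverse p) _) (trans (+-comm _ 1) (cong suc (len-reverse p)))

  ∈verts-reverse : ∀ {a b x} (p : Walk G a b) → x ∈ verts p → x ∈ verts (reverse p)
  ∈verts-reverse []      x∈          = x∈
  ∈verts-reverse (e ∷ p) (here refl) = ∈verts-◅◅⁺ʳ (reverse p) (Edge-sym G e ∷ []) (there (here refl))
  ∈verts-reverse (e ∷ p) (there x∈)  = ∈verts-◅◅⁺ˡ (reverse p) (Edge-sym G e ∷ []) (∈verts-reverse p x∈)

  splitAt : ∀ {a b x} (p : Walk G a b) → x ∈ verts p →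
            Σ (Walk G a x) λ p₁ → Σ (Walk G x b) λ p₂ → p ≡ p₁ ◅◅ p₂
  splitAt []      (here refl) = [] , [] , refl
  splitAt (e ∷ p) (here refl) = [] , e ∷ p , refl
  splitAt (e ∷ p) (there x∈) with p₁ , p₂ , refl ← splitAt p x∈ = e ∷ p₁ , p₂ , refl

-- Covering a graph by detours from a closed walk

module _ {n : ℕ} {G : Graph n} where

  crossing : (P : Fin n → Bool) → ∀ {a b} → Walk G a b → P a ≡ true → P b ≡ false →
             ∃ λ u → ∃ λ w → Edge G u w × P u ≡ true × P w ≡ false
  crossing P []                Pa Pb with () ← trans (sym Pa) Pb
  crossing P (_∷_ {v = v} e p) Pa Pb with P v in Pv
  ... | true  = crossing P p Pv Pb
  ... | false = _ , v , e , Pa , Pv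

  detour : ∀ {a b u w} (W : Walk G a b) → u ∈ verts W → Edge G u w →
           Σ (Walk G a b) λ W′ → len W′ ≡ 2 + len W × w ∈ verts W′ ×
                                  (∀ {x} → x ∈ verts W → x ∈ verts W′)
  detour W u∈W e with W₁ , W₂ , refl ← splitAt W u∈W =
    W₁ ◅◅ (e ∷ Edge-sym G e ∷ W₂) , len-detour , ∈verts-◅◅⁺ʳ W₁ _ (there (here refl)) , W⊆W′
    where
    len-detour : len (W₁ ◅◅ (e ∷ Edge-sym G e ∷ W₂)) ≡ 2 + len (W₁ ◅◅ W₂)
    len-detour = begin
      len (W₁ ◅◅ (e ∷ Edge-sym G e ∷ W₂)) ≡⟨ len-◅◅ W₁ _ ⟩
      len W₁ + (2 + len W₂)              ≡⟨ x∙yz≈y∙xz (len W₁) 2 (len W₂) ⟩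
      2 + (len W₁ + len W₂)              ≡⟨ cong (2 +_) (len-◅◅ W₁ W₂) ⟨
      2 + len (W₁ ◅◅ W₂)                 ∎
      where open ≡-Reasoning
    W⊆W′ : ∀ {x} → x ∈ verts (W₁ ◅◅ W₂) → x ∈ verts (W₁ ◅◅ (e ∷ Edge-sym G e ∷ W₂))
    W⊆W′ x∈ with ∈verts-◅◅⁻ W₁ W₂ x∈
    ... | inj₁ x∈W₁ = ∈verts-◅◅⁺ˡ W₁ _ x∈W₁
    ... | inj₂ x∈W₂ = ∈verts-◅◅⁺ʳ W₁ _ (there (there x∈W₂))

  visited : ∀ {a b} → Walk G a b → Fin n → Bool
  visited W x = x ∈ᵇ verts W

  DetourTour : ∀ {r} → Walk G r r → Set
  DetourTour {r} W = Σ (Walk G r r) λ t → TSPTour G t × len t + 2 * count (visited W) ≤ len W + 2 * n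

  -- Each detour costs two edges and visits at least one new vertex.
  tourByDetours : Connected G → ∀ {r} (W : Walk G r r) → DetourTour W
  tourByDetours connected W = go W (<-wellFounded _)
    where
    go : ∀ {r} (W : Walk G r r) → Acc _<_ (n ∸ count (visited W)) → DetourTour W
    go {r} W (acc smaller) with any? (λ x → visited W x Bool.≟ false)
    ... | no allVisited = W , (λ x → ∈ᵇ⇒∈ (verts W) (¬-not (allVisited ∘ (x ,_)))) ,
                          +-monoʳ-≤ (len W) (*-monoʳ-≤ 2 (count≤n (visited W)))
    ... | yes (x , x∉W) with crossing (visited W) (connected r x) (∈⇒∈ᵇ (start∈verts W)) x∉W
    ...   | u , w , e , u∈W , w∉W with detour W (∈ᵇ⇒∈ (verts W) u∈W) e
    ...     | W′ , lenW′ , w∈W′ , W⊆W′ = cover (go W′ (smaller (∸-monoʳ-< more (count≤n (visited W′)))))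
      where
      more : count (visited W) < count (visited W′)
      more = count-< {P = visited W} {visited W′} (∈ᵇ-mono W⊆W′) w∉W (∈⇒∈ᵇ w∈W′)
      shift : ∀ a c → 2 + (a + 2 * c) ≡ a + 2 * suc c
      shift = solve-∀
      cover : DetourTour W′ → DetourTour W
      cover (t , tour , bound) = t , tour , +-cancelˡ-≤ 2 _ _ (begin
        2 + (len t + 2 * count (visited W)) ≡⟨ shift (len t) (count (visited W)) ⟩
        len t + 2 * suc (count (visited W)) ≤⟨ +-monoʳ-≤ (len t) (*-monoʳ-≤ 2 more) ⟩
        len t + 2 * count (visited W′)      ≤⟨ bound ⟩
        len W′ + 2 * n                      ≡⟨ cong (_+ 2 * n) lenW′ ⟩
        2 + (len W + 2 * n)                 ∎)
        where open ≤-Reasoning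

-- Trees and their leaves

chord⇒HasCycle : ∀ {n} {G : Graph n} {q b c u} (Q : Walk G q b) → Unique (c ∷ verts Q) → Edge G c q → Edge G c u →
                 u ∈ verts Q → u ≢ q → HasCycle G
chord⇒HasCycle {G = G} {c = c} {u} Q !cQ c–q c–u u∈Q u≢q
  with Q₁ , Q₂ , refl ← splitAt Q u∈Q
  with ys , vertsQ₂ ← verts-∷ Q₂ =
  u , Edge-sym G c–u ∷ c–q ∷ Q₁ , s≤s (s≤s (0<len (u≢q ∘ sym) Q₁)) ,
  Unique[xs++y∷ys]⇒Unique[y∷xs] (c ∷ inner Q₁) !cQ₁u
  where
  !cQ₁u : Unique (c ∷ inner Q₁ ++ u ∷ ys)
  !cQ₁u = subst (λ zs → Unique (c ∷ inner Q₁ ++ zs)) vertsQ₂ (subst (Unique ∘ (c ∷_)) (verts-◅◅ Q₁ Q₂) !cQ)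

module _ {n : ℕ} (T : Graph n) where

  treeDegree : (Fin n → Bool) → Fin n → ℕ
  treeDegree S x = count (λ u → S u ∧ adj T x u)

  treeDegree-∖ : ∀ S l x → treeDegree S x ≡ toℕ (S l ∧ adj T x l) + treeDegree (S ∖ l) x
  treeDegree-∖ S l x = trans (count-∖ (λ u → S u ∧ adj T x u) l) (cong (_ +_) (count-cong ∖-∧))
    where
    ∖-∧ : ∀ u → ((λ u → S u ∧ adj T x u) ∖ l) u ≡ (S ∖ l) u ∧ adj T x u
    ∖-∧ u with u ≟ l
    ... | yes _ = refl
    ... | no  _ = refl

module _ {n : ℕ} (T : Graph n) (r : Fin n) where

  Within : (Fin n → Bool) → ∀ {a b} → Walk T a b → Set
  Within S w = All (λ x → S x ≡ true) (verts w)

  ReachesRoot : (Fin n → Bool) → Set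
  ReachesRoot S = ∀ x → S x ≡ true → Σ (Walk T x r) (Within S)

  record Leaf (S : Fin n → Bool) : Set where
    field
      leaf parent      : Fin n
      leaf∈S           : S leaf ≡ true
      parent∈S         : S parent ≡ true
      leaf–parent      : Edge T leaf parent
      leaf≢root        : leaf ≢ r
      unique-neighbour : ∀ u → S u ≡ true → Edge T leaf u → u ≡ parent

  module _ {S : Fin n → Bool} (L : Leaf S) where
    open Leaf L

    treeDegree-leaf : treeDegree T S leaf ≡ 1
    treeDegree-leaf = begin
      treeDegree T S leaf                                     ≡⟨ count-∖ (λ u → S u ∧ adj T leaf u) parent ⟩
      toℕ (S parent ∧ adj T leaf parent) + count (N ∖ parent)
        ≡⟨ cong₂ (λ a b → toℕ (a ∧ b) + count (N ∖ parent)) parent∈S leaf–parent ⟩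
      1 + count (N ∖ parent)                                  ≡⟨ cong suc (trans (count-cong only-parent) (count-false n)) ⟩
      1                                                       ∎
      where
      open ≡-Reasoning
      N = λ u → S u ∧ adj T leaf u
      only-parent : ∀ u → (N ∖ parent) u ≡ false
      only-parent u with u ≟ parent | S u in Su | adj T leaf u in leaf–u
      ... | yes _      | _     | _     = refl
      ... | no  u≢p    | true  | true  = contradiction (unique-neighbour u Su leaf–u) u≢p
      ... | no  _      | true  | false = refl
      ... | no  _      | false | _     = refl

    adjacent-to-leaf : ∀ {x} → S x ≡ true → toℕ (S leaf ∧ adj T x leaf) ≡ δ parent x
    adjacent-to-leaf {x} Sx rewrite leaf∈S with adj T x leaf in x–l
    ... | true  rewrite unique-neighbour x Sx (Edge-sym T x–l) = sym (δ-refl parent)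
    ... | false = sym (δ-≢ {a = parent} {x} λ { refl → case trans (sym x–l) (Edge-sym T leaf–parent) of λ () })

  lastStep : ∀ {S y} (w : Walk T y r) → y ≢ r → Within S w → ∃ λ z → Edge T z r × S z ≡ true
  lastStep []                 y≢r _              = contradiction refl y≢r
  lastStep (_∷_ {v = v} e w) y≢r (Sy ∷ Sw) with v ≟ r
  ... | yes refl = _ , e , Sy
  ... | no  v≢r  = lastStep w v≢r Sw

  -- Walk away from the root as long as possible; by acyclicity the walk never returns to a visited vertex.
  leaf-exists : ∀ {S} → ¬ HasCycle T → ReachesRoot S → S r ≡ true → ∀ {y} → S y ≡ true → y ≢ r → Leaf S
  leaf-exists {S} acyclic reaches Sr Sy y≢r
    with z , z–r , Sz ← lastStep (proj₁ (reaches _ Sy)) y≢r (proj₂ (reaches _ Sy)) =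
    grow [] ((Edge⇒≢ T z–r ∷ []) ∷ [] ∷ []) (Sr ∷ []) Sz z–r (<-wellFounded _)
    where
    grow : ∀ {q c} (Q : Walk T q r) → Unique (c ∷ verts Q) → Within S Q → S c ≡ true → Edge T c q →
           Acc _<_ (n ∸ length (verts Q)) → Leaf S
    grow {q} {c} Q !cQ SQ Sc c–q (acc smaller)
      with any? (λ u → (S u Bool.≟ true) ×-dec (adj T c u Bool.≟ true) ×-dec ¬? (u ≟ q))
    ... | no noOther = record
      { leaf = c ; parent = q ; leaf∈S = Sc ; parent∈S = All.lookup SQ (start∈verts Q) ; leaf–parent = c–q
      ; leaf≢root = λ { refl → Unique[x∷xs]⇒x∉xs !cQ (end∈verts Q) }
      ; unique-neighbour = λ u Su c–u → decidable-stable (u ≟ q) (λ u≢q → noOther (u , Su , c–u , u≢q)) }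
    ... | yes (u , Su , c–u , u≢q) with u ∈? verts Q
    ...   | yes u∈Q = ⊥-elim (acyclic (chord⇒HasCycle Q !cQ c–q c–u u∈Q u≢q))
    ...   | no  u∉Q = grow (c–q ∷ Q) (¬Any⇒All¬ _ u∉cQ ∷ !cQ) (Sc ∷ SQ) Su (Edge-sym T c–u)
                           (smaller (∸-monoʳ-< ≤-refl (Unique⇒length≤n !cQ)))
      where
      u∉cQ : u ∉ c ∷ verts Q
      u∉cQ (here u≡c)  = Edge⇒≢ T c–u (sym u≡c)
      u∉cQ (there u∈Q) = u∉Q u∈Q

  -- A walk through the leaf must arrive from and return to its parent, so that visit can be cut out.
  ReachesRoot-∖ : ∀ {S} → ReachesRoot S → (L : Leaf S) → ReachesRoot (S ∖ Leaf.leaf L)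
  ReachesRoot-∖ {S} reaches L x S∖lx with Sx , x≢l ← ∖-elim {P = S} S∖lx =
    avoid (proj₁ (reaches x Sx)) (proj₂ (reaches x Sx)) x≢l
    where
    open Leaf L
    avoid : ∀ {x} (w : Walk T x r) → Within S w → x ≢ leaf → Σ (Walk T x r) (Within (S ∖ leaf))
    avoid []                Sw x≢l = [] , ∖-intro {P = S} (All.head Sw) x≢l ∷ []
    avoid (_∷_ {v = y} e w) (Sx ∷ Sw) x≢l with y ≟ leaf | w | Sw
    ... | no y≢l   | w       | Sw     with w′ , S∖lw′ ← avoid w Sw y≢l =
      e ∷ w′ , ∖-intro {P = S} Sx x≢l ∷ S∖lw′
    ... | yes refl | []      | _      = contradiction refl leaf≢root
    ... | yes refl | e′ ∷ w′ | _ ∷ Sw′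
      with unique-neighbour _ Sx (Edge-sym T e) | unique-neighbour _ (All.lookup Sw′ (start∈verts w′)) e′
    ...   | refl | refl = avoid w′ Sw′ x≢l

-- A list of walks stands for the multigraph with one edge per walk, joining its two ends.
data SomeWalk {n : ℕ} (G : Graph n) : Set where
  ⟨_⟩ : ∀ {a b} → Walk G a b → SomeWalk G

module _ {n : ℕ} {G : Graph n} where

  start end : SomeWalk G → Fin n
  start (⟨_⟩ {a} w)     = a
  end   (⟨_⟩ {b = b} w) = b

  lenˢ : SomeWalk G → ℕ
  lenˢ ⟨ w ⟩ = len w

  _∈ˢ_ : Fin n → SomeWalk G → Set
  x ∈ˢ ⟨ w ⟩ = x ∈ verts w

  ends : SomeWalk G → Fin n → ℕ
  ends w x = δ (start w) x + δ (end w) x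

  degree : List (SomeWalk G) → Fin n → ℕ
  degree J x = sum (map (λ w → ends w x) J)

  totalLen : List (SomeWalk G) → ℕ
  totalLen J = sum (map lenˢ J)

  _∈ᴶ_ : Fin n → List (SomeWalk G) → Set
  x ∈ᴶ J = Any (x ∈ˢ_) J

  EndsIn : (Fin n → Bool) → List (SomeWalk G) → Set
  EndsIn S J = All (λ w → S (start w) ≡ true × S (end w) ≡ true) J

  degree-++ : ∀ J K x → degree (J ++ K) x ≡ degree J x + degree K x
  degree-++ J K x = trans (cong sum (map-++ _ J K)) (sum-++ (map _ J) _)

  totalLen-++ : ∀ J K → totalLen (J ++ K) ≡ totalLen J + totalLen K
  totalLen-++ J K = trans (cong sum (map-++ _ J K)) (sum-++ (map _ J) _)

  data View (l : Fin n) : SomeWalk G → Set where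
    away : ∀ {a b} (w : Walk G a b) → a ≢ l → b ≢ l → View l ⟨ w ⟩
    loop : (w : Walk G l l) → View l ⟨ w ⟩
    out  : ∀ {b} (w : Walk G l b) → b ≢ l → View l ⟨ w ⟩
    into : ∀ {a} (w : Walk G a l) → a ≢ l → View l ⟨ w ⟩

  view : ∀ l w → View l w
  view l (⟨_⟩ {a} {b} w) with a ≟ l | b ≟ l
  ... | yes refl | yes refl = loop w
  ... | yes refl | no b≢l   = out w b≢l
  ... | no a≢l   | yes refl = into w a≢l
  ... | no a≢l   | no b≢l   = away w a≢l b≢l

  Spoke : Fin n → Set
  Spoke l = Σ (Fin n) (Walk G l)

  tip : ∀ {l} → Spoke l → Fin n
  tip = proj₁

  awayFrom : ∀ l → List (SomeWalk G) → List (SomeWalk G)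
  awayFrom l []      = []
  awayFrom l (w ∷ J) with view l w
  ... | away _ _ _ = w ∷ awayFrom l J
  ... | loop _     = awayFrom l J
  ... | out  _ _   = awayFrom l J
  ... | into _ _   = awayFrom l J

  loopsAt : ∀ l → List (SomeWalk G) → List (Walk G l l)
  loopsAt l []      = []
  loopsAt l (w ∷ J) with view l w
  ... | away _ _ _ = loopsAt l J
  ... | loop w′    = w′ ∷ loopsAt l J
  ... | out  _ _   = loopsAt l J
  ... | into _ _   = loopsAt l J

  spokesAt : ∀ l → List (SomeWalk G) → List (Spoke l)
  spokesAt l []      = []
  spokesAt l (w ∷ J) with view l w
  ... | away _ _ _ = spokesAt l J
  ... | loop _     = spokesAt l J
  ... | out  w′ _  = (_ , w′) ∷ spokesAt l J
  ... | into w′ _  = (_ , reverse w′) ∷ spokesAt l J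

  tips : ∀ {l} → List (Spoke l) → Fin n → ℕ
  tips M x = sum (map (λ s → δ (tip s) x) M)

  spokesLen : ∀ {l} → List (Spoke l) → ℕ
  spokesLen M = sum (map (len ∘ proj₂) M)

  degree-split : ∀ {l x} J → x ≢ l → degree J x ≡ degree (awayFrom l J) x + tips (spokesAt l J) x
  degree-split                []      x≢l = refl
  degree-split {l} {x} (w ∷ J) x≢l with view l w
  ... | away _ _ _ = trans (cong (ends w x +_) (degree-split J x≢l)) (sym (+-assoc (ends w x) _ _))
  ... | loop _     = trans (cong₂ (λ i j → i + j + degree J x) l≁x l≁x) (degree-split J x≢l)
    where l≁x = δ-≢ (x≢l ∘ sym)
  ... | out {b} _ _  = trans (cong (λ i → i + δ b x + degree J x) (δ-≢ (x≢l ∘ sym)))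
                       (trans (cong (δ b x +_) (degree-split J x≢l))
                              (x∙yz≈y∙xz (δ b x) (degree (awayFrom l J) x) _))
  ... | into {a} _ _ = trans (cong (λ i → δ a x + i + degree J x) (δ-≢ (x≢l ∘ sym)))
                       (trans (cong₂ _+_ (+-identityʳ (δ a x)) (degree-split J x≢l))
                              (x∙yz≈y∙xz (δ a x) (degree (awayFrom l J) x) _))

  degree-at : ∀ l J → degree J l ≡ 2 * length (loopsAt l J) + length (spokesAt l J)
  degree-at l []      = refl
  degree-at l (w ∷ J) with view l w
  ... | away _ a≢l b≢l = trans (cong₂ (λ i j → i + j + degree J l) (δ-≢ a≢l) (δ-≢ b≢l)) (degree-at l J)
  ... | loop _         = trans (cong₂ (λ i j → i + j + degree J l) (δ-refl l) (δ-refl l))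
                               (trans (cong (2 +_) (degree-at l J)) (shift (length (loopsAt l J)) _))
    where shift : ∀ a b → 2 + (2 * a + b) ≡ 2 * suc a + b
          shift = solve-∀
  ... | out  _ b≢l     = trans (cong₂ (λ i j → i + j + degree J l) (δ-refl l) (δ-≢ b≢l))
                               (trans (cong suc (degree-at l J)) (sym (+-suc _ _)))
  ... | into _ a≢l     = trans (cong₂ (λ i j → i + j + degree J l) (δ-≢ a≢l) (δ-refl l))
                               (trans (cong suc (degree-at l J)) (sym (+-suc _ _)))

  loopsLen : ∀ {l} → List (Walk G l l) → ℕ
  loopsLen L = sum (map len L)

  private
    into-loops : ∀ w a b c → w + (a + (b + c)) ≡ a + (w + b + c)
    into-loops  w a b c = trans (x∙yz≈y∙xz w a (b + c)) (cong (a +_) (sym (+-assoc w b c)))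
    into-spokes : ∀ w a b c → w + (a + (b + c)) ≡ a + (b + (w + c))
    into-spokes w a b c = trans (x∙yz≈y∙xz w a (b + c)) (cong (a +_) (x∙yz≈y∙xz w b c))

  totalLen-split : ∀ l J → totalLen J ≡ totalLen (awayFrom l J) + (loopsLen (loopsAt l J) + spokesLen (spokesAt l J))
  totalLen-split l []      = refl
  totalLen-split l (w ∷ J) with view l w
  ... | away w′ _ _ = trans (cong (len w′ +_) (totalLen-split l J))
                            (sym (+-assoc (len w′) (totalLen (awayFrom l J)) _))
  ... | loop w′     = trans (cong (len w′ +_) (totalLen-split l J))
                            (into-loops (len w′) (totalLen (awayFrom l J))
                                        (loopsLen (loopsAt l J)) (spokesLen (spokesAt l J)))
  ... | out  w′ _   = trans (cong (len w′ +_) (totalLen-split l J))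
                            (into-spokes (len w′) (totalLen (awayFrom l J))
                                         (loopsLen (loopsAt l J)) (spokesLen (spokesAt l J)))
  ... | into w′ _   = trans (cong₂ _+_ (sym (len-reverse w′)) (totalLen-split l J))
                            (into-spokes (len (reverse w′)) (totalLen (awayFrom l J))
                                         (loopsLen (loopsAt l J)) (spokesLen (spokesAt l J)))

  ∈ᴶ-split : ∀ {l x} J → x ∈ᴶ J →
             x ∈ᴶ awayFrom l J ⊎ Any (λ w → x ∈ verts w) (loopsAt l J) ⊎
             Any (λ s → x ∈ verts (proj₂ s)) (spokesAt l J)
  ∈ᴶ-split {l} (w ∷ J) x∈ with view l w | x∈
  ... | away _ _ _ | here x∈w  = inj₁ (here x∈w)
  ... | loop _     | here x∈w  = inj₂ (inj₁ (here x∈w))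
  ... | out  _ _   | here x∈w  = inj₂ (inj₂ (here x∈w))
  ... | into w′ _  | here x∈w  = inj₂ (inj₂ (here (∈verts-reverse w′ x∈w)))
  ... | away _ _ _ | there x∈J = Sum.map₁ there (∈ᴶ-split J x∈J)
  ... | loop _     | there x∈J = Sum.map₂ (Sum.map₁ there) (∈ᴶ-split J x∈J)
  ... | out  _ _   | there x∈J = Sum.map₂ (Sum.map₂ there) (∈ᴶ-split J x∈J)
  ... | into _ _   | there x∈J = Sum.map₂ (Sum.map₂ there) (∈ᴶ-split J x∈J)

  EndsIn-split : ∀ {S l} J → EndsIn S J →
                 EndsIn (S ∖ l) (awayFrom l J) × All (λ s → (S ∖ l) (tip s) ≡ true) (spokesAt l J)
  EndsIn-split                []      []                = [] , []
  EndsIn-split {S} {l} (w ∷ J) ((Sa , Sb) ∷ SJ) with view l w | EndsIn-split {S} {l} J SJ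
  ... | away _ a≢l b≢l | SJa , SJs = (∖-intro {P = S} Sa a≢l , ∖-intro {P = S} Sb b≢l) ∷ SJa , SJs
  ... | loop _         | SJa , SJs = SJa , SJs
  ... | out  _ b≢l     | SJa , SJs = SJa , ∖-intro {P = S} Sb b≢l ∷ SJs
  ... | into _ a≢l     | SJa , SJs = SJa , ∖-intro {P = S} Sa a≢l ∷ SJs

  concatLoops : ∀ {l} → List (Walk G l l) → Walk G l l
  concatLoops []      = []
  concatLoops (w ∷ L) = w ◅◅ concatLoops L

  len-concatLoops : ∀ {l} (L : List (Walk G l l)) → len (concatLoops L) ≡ loopsLen L
  len-concatLoops []      = refl
  len-concatLoops (w ∷ L) = trans (len-◅◅ w _) (cong (len w +_) (len-concatLoops L))

  ∈verts-concatLoops : ∀ {l x} (L : List (Walk G l l)) → Any (λ w → x ∈ verts w) L → x ∈ verts (concatLoops L)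
  ∈verts-concatLoops (w ∷ L) (here x∈w)  = ∈verts-◅◅⁺ˡ w _ x∈w
  ∈verts-concatLoops (w ∷ L) (there x∈L) = ∈verts-◅◅⁺ʳ w _ (∈verts-concatLoops L x∈L)

  pairUp : ∀ {l} → List (Spoke l) → List (SomeWalk G)
  pairUp []                          = []
  pairUp ((_ , w) ∷ [])              = ⟨ w ⟩ ∷ []
  pairUp ((_ , w₁) ∷ (_ , w₂) ∷ M) = ⟨ reverse w₁ ◅◅ w₂ ⟩ ∷ pairUp M

  degree-pairUp : ∀ {l x} (M : List (Spoke l)) → x ≢ l → degree (pairUp M) x ≡ tips M x
  degree-pairUp                 []                        x≢l = refl
  degree-pairUp                 ((b , _) ∷ [])            x≢l = cong (λ i → i + δ b _ + 0) (δ-≢ (x≢l ∘ sym))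
  degree-pairUp {x = x} ((b₁ , _) ∷ (b₂ , _) ∷ M) x≢l =
    trans (cong (δ b₁ x + δ b₂ x +_) (degree-pairUp M x≢l)) (+-assoc (δ b₁ x) (δ b₂ x) (tips M x))

  totalLen-pairUp : ∀ {l} (M : List (Spoke l)) → totalLen (pairUp M) ≡ spokesLen M
  totalLen-pairUp []                         = refl
  totalLen-pairUp ((_ , w) ∷ [])             = refl
  totalLen-pairUp ((_ , w₁) ∷ (_ , w₂) ∷ M) = begin
    len (reverse w₁ ◅◅ w₂) + totalLen (pairUp M) ≡⟨ cong₂ _+_ (len-◅◅ (reverse w₁) w₂) (totalLen-pairUp M) ⟩
    len (reverse w₁) + len w₂ + spokesLen M      ≡⟨ cong (λ i → i + len w₂ + spokesLen M) (len-reverse w₁) ⟩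
    len w₁ + len w₂ + spokesLen M                ≡⟨ +-assoc (len w₁) (len w₂) (spokesLen M) ⟩
    len w₁ + (len w₂ + spokesLen M)              ∎
    where open ≡-Reasoning

  ∈ᴶ-pairUp : ∀ {l x} (M : List (Spoke l)) → Any (λ s → x ∈ verts (proj₂ s)) M → x ∈ᴶ pairUp M
  ∈ᴶ-pairUp ((_ , w) ∷ [])             (here x∈w)          = here x∈w
  ∈ᴶ-pairUp ((_ , w₁) ∷ (_ , w₂) ∷ M) (here x∈w₁)         =
    here (∈verts-◅◅⁺ˡ (reverse w₁) w₂ (∈verts-reverse w₁ x∈w₁))
  ∈ᴶ-pairUp ((_ , w₁) ∷ (_ , w₂) ∷ M) (there (here x∈w₂)) = here (∈verts-◅◅⁺ʳ (reverse w₁) w₂ x∈w₂)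
  ∈ᴶ-pairUp ((_ , w₁) ∷ (_ , w₂) ∷ M) (there (there x∈M)) = there (∈ᴶ-pairUp M x∈M)

  EndsIn-pairUp : ∀ {S l} (M : List (Spoke l)) → parity (length M) ≡ 0ℙ → All (λ s → S (tip s) ≡ true) M →
                  EndsIn S (pairUp M)
  EndsIn-pairUp []                         _    []               = []
  EndsIn-pairUp ((_ , w₁) ∷ (_ , w₂) ∷ M) even (Sb₁ ∷ Sb₂ ∷ SM) = (Sb₁ , Sb₂) ∷ EndsIn-pairUp M even SM

  -- Splitting off at l: every walk ending at l is joined, through l, to another one; the closed walks at l are
  -- absorbed into the walk s from l to p.
  stem : ∀ {l p} → Walk G l p → List (SomeWalk G) → Spoke l
  stem {l} {p} s J = p , concatLoops (loopsAt l J) ◅◅ s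

  allSpokes : ∀ {l p} → Walk G l p → List (SomeWalk G) → List (Spoke l)
  allSpokes {l} s J = stem s J ∷ spokesAt l J

  splice : ∀ {l p} → Walk G l p → List (SomeWalk G) → List (SomeWalk G)
  splice {l} s J = awayFrom l J ++ pairUp (allSpokes s J)

  degree-splice : ∀ {l p x} (s : Walk G l p) J → x ≢ l → degree (splice s J) x ≡ δ p x + degree J x
  degree-splice {l} {p} {x} s J x≢l = begin
    degree (splice s J) x                        ≡⟨ degree-++ (awayFrom l J) (pairUp (allSpokes s J)) x ⟩
    A + degree (pairUp (allSpokes s J)) x        ≡⟨ cong (A +_) (degree-pairUp (allSpokes s J) x≢l) ⟩
    A + (δ p x + tips (spokesAt l J) x)          ≡⟨ x∙yz≈y∙xz A (δ p x) (tips (spokesAt l J) x) ⟩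
    δ p x + (A + tips (spokesAt l J) x)          ≡⟨ cong (δ p x +_) (degree-split J x≢l) ⟨
    δ p x + degree J x                           ∎
    where
    open ≡-Reasoning
    A = degree (awayFrom l J) x

  totalLen-splice : ∀ {l p} (s : Walk G l p) J → totalLen (splice s J) ≡ len s + totalLen J
  totalLen-splice {l} s J = begin
    totalLen (splice s J)                        ≡⟨ totalLen-++ (awayFrom l J) (pairUp (allSpokes s J)) ⟩
    A + totalLen (pairUp (allSpokes s J))        ≡⟨ cong (A +_) (totalLen-pairUp (allSpokes s J)) ⟩
    A + (len (concatLoops (loopsAt l J) ◅◅ s) + N)
      ≡⟨ cong (λ i → A + (i + N)) (trans (len-◅◅ (concatLoops (loopsAt l J)) s)
                                         (cong (_+ len s) (len-concatLoops (loopsAt l J)))) ⟩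
    A + (L + len s + N)                          ≡⟨ shift A L (len s) N ⟩
    len s + (A + (L + N))                        ≡⟨ cong (len s +_) (totalLen-split l J) ⟨
    len s + totalLen J                           ∎
    where
    open ≡-Reasoning
    A = totalLen (awayFrom l J)
    L = loopsLen (loopsAt l J)
    N = spokesLen (spokesAt l J)
    shift : ∀ a b c d → a + (b + c + d) ≡ c + (a + (b + d))
    shift = solve-∀

  ∈ᴶ-splice : ∀ {l p x} (s : Walk G l p) J → x ∈ verts s ⊎ x ∈ᴶ J → x ∈ᴶ splice s J
  ∈ᴶ-splice {l} s J (inj₁ x∈s)  = Any-++⁺ʳ (awayFrom l J) (∈ᴶ-pairUp (allSpokes s J)
                                     (here (∈verts-◅◅⁺ʳ (concatLoops (loopsAt l J)) s x∈s)))
  ∈ᴶ-splice {l} s J (inj₂ x∈J) with ∈ᴶ-split J x∈J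
  ... | inj₁ x∈away          = Any-++⁺ˡ x∈away
  ... | inj₂ (inj₁ x∈loops)  = Any-++⁺ʳ (awayFrom l J) (∈ᴶ-pairUp (allSpokes s J)
                                          (here (∈verts-◅◅⁺ˡ _ s (∈verts-concatLoops _ x∈loops))))
  ... | inj₂ (inj₂ x∈spokes) = Any-++⁺ʳ (awayFrom l J) (∈ᴶ-pairUp (allSpokes s J) (there x∈spokes))

  -- Together with the stem the spokes are even in number: each closed walk at l has both ends there.
  EndsIn-splice : ∀ {S l p} (s : Walk G l p) J → p ≢ l → S p ≡ true → parity (suc (degree J l)) ≡ 0ℙ →
                  EndsIn S J → EndsIn (S ∖ l) (splice s J)
  EndsIn-splice {S} {l} s J p≢l Sp even SJ with SJa , SJs ← EndsIn-split {S} {l} J SJ =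
    All-++⁺ SJa (EndsIn-pairUp (allSpokes s J) evenSpokes (∖-intro {P = S} Sp p≢l ∷ SJs))
    where
    open ≡-Reasoning
    loops = length (loopsAt l J)
    spokes = length (spokesAt l J)
    evenSpokes : parity (suc spokes) ≡ 0ℙ
    evenSpokes = begin
      parity (suc spokes)                ≡⟨ parity-2*+ loops (suc spokes) ⟨
      parity (2 * loops + suc spokes)    ≡⟨ cong parity (+-suc (2 * loops) spokes) ⟩
      parity (suc (2 * loops + spokes))  ≡⟨ cong (parity ∘ suc) (degree-at l J) ⟨
      parity (suc (degree J l))          ≡⟨ even ⟩
      0ℙ                                 ∎

  ClosedAt : Fin n → List (SomeWalk G) → Set
  ClosedAt r J = All (λ w → start w ≡ r × end w ≡ r) J

  concatClosed : ∀ {r} J → ClosedAt r J → Walk G r r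
  concatClosed []          []                    = []
  concatClosed (⟨ w ⟩ ∷ J) ((refl , refl) ∷ atR) = w ◅◅ concatClosed J atR

  len-concatClosed : ∀ {r} J (atR : ClosedAt r J) → len (concatClosed J atR) ≡ totalLen J
  len-concatClosed []          []                    = refl
  len-concatClosed (⟨ w ⟩ ∷ J) ((refl , refl) ∷ atR) =
    trans (len-◅◅ w _) (cong (len w +_) (len-concatClosed J atR))

  ∈verts-concatClosed : ∀ {r x} J (atR : ClosedAt r J) → x ∈ᴶ J → x ∈ verts (concatClosed J atR)
  ∈verts-concatClosed (⟨ w ⟩ ∷ J) ((refl , refl) ∷ atR) (here x∈w)  = ∈verts-◅◅⁺ˡ w _ x∈w
  ∈verts-concatClosed (⟨ w ⟩ ∷ J) ((refl , refl) ∷ atR) (there x∈J) =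
    ∈verts-◅◅⁺ʳ w _ (∈verts-concatClosed J atR x∈J)

-- Closed walks through a tree and a system of walks

module _ {n : ℕ} {G : Graph n} (T : Graph n) (r : Fin n) where

  EvenOffRoot : (Fin n → Bool) → List (SomeWalk G) → Set
  EvenOffRoot S J = ∀ x → S x ≡ true → x ≢ r → parity (treeDegree T S x + degree J x) ≡ 0ℙ

  record Eulerian (S : Fin n → Bool) (J : List (SomeWalk G)) : Set where
    field
      root∈S  : S r ≡ true
      reaches : ReachesRoot T r S
      ends∈S  : EndsIn S J
      even    : EvenOffRoot S J

  Tour : (Fin n → Bool) → List (SomeWalk G) → Set
  Tour S J = Σ (Walk G r r) λ t → (∀ x → S x ≡ true ⊎ x ∈ᴶ J → x ∈ verts t) ×
                                   suc (len t) ≤ count S + totalLen J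

  tourAtRoot : ∀ {S J} → Eulerian S J → (∀ {y} → S y ≡ true → y ≡ r) → Tour S J
  tourAtRoot {S} {J} E onlyRoot =
    t , cover , subst (λ k → suc k ≤ count S + totalLen J) (sym (len-concatClosed J atRoot))
                      (+-monoˡ-≤ (totalLen J) (0<count S root∈S))
    where
    open Eulerian E
    atRoot = All.map (Product.map onlyRoot onlyRoot) ends∈S
    t = concatClosed J atRoot
    cover : ∀ x → S x ≡ true ⊎ x ∈ᴶ J → x ∈ verts t
    cover x (inj₁ Sx)  = subst (_∈ verts t) (sym (onlyRoot Sx)) (start∈verts t)
    cover x (inj₂ x∈J) = ∈verts-concatClosed J atRoot x∈J

  module _ (T⊆G : Subgraph T G) {S : Fin n → Bool} (L : Leaf T r S) where
    open Leaf L

    toParent : Walk G leaf parent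
    toParent = T⊆G leaf parent leaf–parent ∷ []

    -- The tree edge from the leaf to its parent becomes the stem of the splice at the leaf.
    Eulerian-∖ : ∀ {J} → Eulerian S J → Eulerian (S ∖ leaf) (splice toParent J)
    Eulerian-∖ {J} E = record
      { root∈S  = ∖-intro {P = S} root∈S (leaf≢root ∘ sym)
      ; reaches = ReachesRoot-∖ T r reaches L
      ; ends∈S  = EndsIn-splice {S = S} toParent J (Edge⇒≢ T leaf–parent ∘ sym) parent∈S evenAtLeaf ends∈S
      ; even    = even′
      }
      where
      open Eulerian E
      evenAtLeaf : parity (suc (degree J leaf)) ≡ 0ℙ
      evenAtLeaf = subst (λ d → parity (d + degree J leaf) ≡ 0ℙ) (treeDegree-leaf T r L)
                         (even leaf leaf∈S leaf≢root)
      even′ : EvenOffRoot (S ∖ leaf) (splice toParent J)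
      even′ x S∖lx x≢r with Sx , x≢l ← ∖-elim {P = S} S∖lx = trans (cong parity degrees) (even x Sx x≢r)
        where
        degrees : treeDegree T (S ∖ leaf) x + degree (splice toParent J) x ≡ treeDegree T S x + degree J x
        degrees = begin
          D′ + degree (splice toParent J) x               ≡⟨ cong (D′ +_) (degree-splice toParent J x≢l) ⟩
          D′ + (δ parent x + degree J x)                  ≡⟨ x∙yz≈yx∙z D′ (δ parent x) (degree J x) ⟩
          δ parent x + D′ + degree J x                    ≡⟨ cong (λ d → d + D′ + degree J x) (adjacent-to-leaf T r L Sx) ⟨
          toℕ (S leaf ∧ adj T x leaf) + D′ + degree J x   ≡⟨ cong (_+ degree J x) (treeDegree-∖ T S leaf x) ⟨
          treeDegree T S x + degree J x                   ∎
          where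
          open ≡-Reasoning
          D′ = treeDegree T (S ∖ leaf) x

    Tour-∖ : ∀ {J} → Tour (S ∖ leaf) (splice toParent J) → Tour S J
    Tour-∖ {J} (t , cover , bound) = t , cover′ , subst (suc (len t) ≤_) sizes bound
      where
      cover′ : ∀ x → S x ≡ true ⊎ x ∈ᴶ J → x ∈ verts t
      cover′ x (inj₁ Sx) with x ≟ leaf
      ... | yes refl = cover x (inj₂ (∈ᴶ-splice toParent J (inj₁ (here refl))))
      ... | no  x≢l  = cover x (inj₁ (∖-intro {P = S} Sx x≢l))
      cover′ x (inj₂ x∈J) = cover x (inj₂ (∈ᴶ-splice toParent J (inj₂ x∈J)))
      sizes : count (S ∖ leaf) + totalLen (splice toParent J) ≡ count S + totalLen J
      sizes = begin
        count (S ∖ leaf) + totalLen (splice toParent J) ≡⟨ cong (count (S ∖ leaf) +_) (totalLen-splice toParent J) ⟩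
        count (S ∖ leaf) + suc (totalLen J)             ≡⟨ +-suc (count (S ∖ leaf)) (totalLen J) ⟩
        suc (count (S ∖ leaf)) + totalLen J             ≡⟨ cong (_+ totalLen J) (count-∖-∈ S leaf∈S) ⟨
        count S + totalLen J                            ∎
        where open ≡-Reasoning

  -- Euler's argument: remove the leaves of the tree one at a time.
  eulerTour : Subgraph T G → ¬ HasCycle T → ∀ {S J} → Eulerian S J → Tour S J
  eulerTour T⊆G acyclic = go (<-wellFounded _)
    where
    go : ∀ {S J} → Acc _<_ (count S) → Eulerian S J → Tour S J
    go {S} (acc smaller) E with any? (λ y → (S y Bool.≟ true) ×-dec ¬? (y ≟ r))
    ... | no onlyRoot = tourAtRoot E (λ {y} Sy → decidable-stable (y ≟ r) (onlyRoot ∘ (y ,_) ∘ (Sy ,_)))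
    ... | yes (y , Sy , y≢r) =
      Tour-∖ T⊆G L (go (smaller fewer) (Eulerian-∖ T⊆G L E))
      where
      L = leaf-exists T r acyclic (Eulerian.reaches E) (Eulerian.root∈S E) Sy y≢r
      fewer : count (S ∖ Leaf.leaf L) < count S
      fewer = subst (count (S ∖ Leaf.leaf L) <_) (sym (count-∖-∈ S (Leaf.leaf∈S L))) ≤-refl

-- Two classes of edges of a walk, swapping at the vertices marked odd

module _ {n : ℕ} {G : Graph n} (odd : Fin n → Parity) where

  edgeIf : Parity → Parity → ∀ {a b} → Edge G a b → List (SomeWalk G) → List (SomeWalk G)
  edgeIf g c e R = if does (c ℙ≟ g) then ⟨ e ∷ [] ⟩ ∷ R else R

  classEdges : Parity → Parity → ∀ {a b} → Walk G a b → List (SomeWalk G)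
  classEdges g c []                = []
  classEdges g c (_∷_ {v = v} e p) = edgeIf g c e (classEdges g (c ℙ.+ odd v) p)

  totalLen-classEdges : ∀ c {a b} (p : Walk G a b) →
                        totalLen (classEdges 0ℙ c p) + totalLen (classEdges 1ℙ c p) ≡ len p
  totalLen-classEdges c  []      = refl
  totalLen-classEdges 0ℙ (e ∷ p) = cong suc (totalLen-classEdges _ p)
  totalLen-classEdges 1ℙ (e ∷ p) = trans (+-suc _ _) (cong suc (totalLen-classEdges _ p))

  degree-edgeIf : ∀ g c {a b x} (e : Edge G a b) R →
                  degree (edgeIf g c e R) x ≡ toℕ (does (c ℙ≟ g)) * (δ a x + δ b x) + degree R x
  degree-edgeIf g c {a} {b} {x} e R with c ℙ≟ g
  ... | yes _ = cong (_+ degree R x) (sym (*-identityˡ (δ a x + δ b x)))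
  ... | no  _ = refl

  degree-edgeIf-≢ : ∀ g c {a b x} (e : Edge G a b) R → a ≢ x → b ≢ x → degree (edgeIf g c e R) x ≡ degree R x
  degree-edgeIf-≢ g c {a} {b} {x} e R a≢x b≢x = begin
    degree (edgeIf g c e R) x         ≡⟨ degree-edgeIf g c e R ⟩
    k * (δ a x + δ b x) + degree R x  ≡⟨ cong₂ (λ i j → k * (i + j) + degree R x) (δ-≢ a≢x) (δ-≢ b≢x) ⟩
    k * 0 + degree R x                ≡⟨ cong (_+ degree R x) (*-zeroʳ k) ⟩
    degree R x                        ∎
    where
    open ≡-Reasoning
    k = toℕ (does (c ℙ≟ g))

  degree-classEdges-∉ : ∀ g c {a b x} (p : Walk G a b) → x ∉ verts p → degree (classEdges g c p) x ≡ 0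
  degree-classEdges-∉ g c []                x∉p = refl
  degree-classEdges-∉ g c (_∷_ {v = v} e p) x∉p =
    trans (degree-edgeIf-≢ g c e _ (x∉p ∘ here ∘ sym) (x∉p ∘ there ∘ λ { refl → start∈verts p }))
          (degree-classEdges-∉ g _ p (x∉p ∘ there))

  parity-switch : ∀ g c o → parity (toℕ (does (c ℙ≟ g)) + toℕ (does ((c ℙ.+ o) ℙ≟ g))) ≡ o
  parity-switch 0ℙ 0ℙ 0ℙ = refl
  parity-switch 0ℙ 0ℙ 1ℙ = refl
  parity-switch 0ℙ 1ℙ 0ℙ = refl
  parity-switch 0ℙ 1ℙ 1ℙ = refl
  parity-switch 1ℙ 0ℙ 0ℙ = refl
  parity-switch 1ℙ 0ℙ 1ℙ = refl
  parity-switch 1ℙ 1ℙ 0ℙ = refl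
  parity-switch 1ℙ 1ℙ 1ℙ = refl

  -- At an inner vertex x the class switches exactly when odd x = 1ℙ, and x meets one edge of each of the two
  -- classes involved.
  parity-degree-classEdges : ∀ g c {a b x} (p : Walk G a b) → Unique (inner p) → x ∈ inner p → x ≢ a → x ≢ b →
                             parity (degree (classEdges g c p) x) ≡ odd x
  parity-degree-classEdges g c (e ∷ p) _ (here refl) x≢a _ = contradiction refl x≢a
  parity-degree-classEdges g c {x = x} (_∷_ {v = v} e p) (_ ∷ !p) (there x∈p) x≢a x≢b with v ≟ x
  ... | no v≢x = trans (cong parity (degree-edgeIf-≢ g c e _ (x≢a ∘ sym) v≢x))
                       (parity-degree-classEdges g _ p !p x∈p (v≢x ∘ sym) x≢b)
  parity-degree-classEdges g c {a} {x = x} (_∷_ e (_∷_ {v = w} e′ p)) (_ ∷ x∉p ∷ _) (there _) x≢a x≢b | yes refl =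
    begin
    parity (degree (classEdges g c (e ∷ e′ ∷ p)) x)
      ≡⟨ cong parity (trans (degree-edgeIf g c e _) (cong (_ +_) (degree-edgeIf g c′ e′ _))) ⟩
    parity (k * (δ a x + δ x x) + (k′ * (δ x x + δ w x) + degree R x))
      ≡⟨ cong parity (cong₂ (λ i j → k * i + (k′ * j + degree R x))
                            (cong₂ _+_ (δ-≢ (x≢a ∘ sym)) (δ-refl x)) (cong₂ _+_ (δ-refl x) (δ-≢ (Edge⇒≢ G e′ ∘ sym)))) ⟩
    parity (k * 1 + (k′ * 1 + degree R x))
      ≡⟨ cong parity (cong₂ (λ i j → i + (j + degree R x)) (*-identityʳ k) (*-identityʳ k′)) ⟩
    parity (k + (k′ + degree R x))
      ≡⟨ cong (λ d → parity (k + (k′ + d))) (degree-classEdges-∉ g _ p (∉verts p (All¬⇒¬Any x∉p) x≢b)) ⟩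
    parity (k + (k′ + 0))
      ≡⟨ cong (λ d → parity (k + d)) (+-identityʳ k′) ⟩
    parity (k + k′)
      ≡⟨ parity-switch g c (odd x) ⟩
    odd x ∎
    where
    open ≡-Reasoning
    c′ = c ℙ.+ odd x
    k  = toℕ (does (c ℙ≟ g))
    k′ = toℕ (does (c′ ℙ≟ g))
    R  = classEdges g (c′ ℙ.+ odd w) p

  lighterClass : ∀ {a b} (p : Walk G a b) → ∃ λ g → 2 * totalLen (classEdges g 0ℙ p) ≤ len p
  lighterClass p with 2*m≤m+n⊎2*n≤m+n (totalLen (classEdges 0ℙ 0ℙ p)) (totalLen (classEdges 1ℙ 0ℙ p))
  ... | inj₁ light = 0ℙ , subst (2 * totalLen (classEdges 0ℙ 0ℙ p) ≤_) (totalLen-classEdges 0ℙ p) light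
  ... | inj₂ light = 1ℙ , subst (2 * totalLen (classEdges 1ℙ 0ℙ p) ≤_) (totalLen-classEdges 0ℙ p) light

-- The two tours

detour-arith : ∀ {t k m n} → t + 2 * m ≤ k + 2 * n → k ≤ m → 2 * n ≤ 3 * k → 3 * t ≤ 4 * n
detour-arith {t} {k} {m} {n} bound k≤m long = +-cancelʳ-≤ (2 * n) (3 * t) (4 * n) (begin
  3 * t + 2 * n ≤⟨ +-monoʳ-≤ (3 * t) long ⟩
  3 * t + 3 * k ≤⟨ +-cancelʳ-≤ (3 * k) _ _ (begin
    3 * t + 3 * k + 3 * k ≡⟨ e₁ t k ⟩
    3 * (t + 2 * k)       ≤⟨ *-monoʳ-≤ 3 (+-monoʳ-≤ t (*-monoʳ-≤ 2 k≤m)) ⟩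
    3 * (t + 2 * m)       ≤⟨ *-monoʳ-≤ 3 bound ⟩
    3 * (k + 2 * n)       ≡⟨ e₂ k n ⟩
    6 * n + 3 * k         ∎) ⟩
  6 * n                 ≡⟨ e₃ n ⟩
  4 * n + 2 * n         ∎)
  where
  open ≤-Reasoning
  e₁ : ∀ t k → 3 * t + 3 * k + 3 * k ≡ 3 * (t + 2 * k)
  e₁ = solve-∀
  e₂ : ∀ k n → 3 * (k + 2 * n) ≡ 6 * n + 3 * k
  e₂ = solve-∀
  e₃ : ∀ n → 6 * n ≡ 4 * n + 2 * n
  e₃ = solve-∀

euler-arith : ∀ {t j k n} → suc t ≤ n + j → 2 * j ≤ k → 3 * k < 2 * n → 3 * t ≤ 4 * n
euler-arith {t} {j} {k} {n} bound light short = <⇒≤ (*-cancelˡ-< 2 (3 * t) (4 * n) (begin-strict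
  2 * (3 * t)           <⟨ n<1+n _ ⟩
  suc (2 * (3 * t))     ≤⟨ m≤m+n _ 5 ⟩
  suc (2 * (3 * t)) + 5 ≡⟨ e₁ t ⟩
  6 * suc t             ≤⟨ *-monoʳ-≤ 6 bound ⟩
  6 * (n + j)           ≡⟨ e₂ n j ⟩
  6 * n + 3 * (2 * j)   ≤⟨ +-monoʳ-≤ (6 * n) (*-monoʳ-≤ 3 light) ⟩
  6 * n + 3 * k         <⟨ +-monoʳ-< (6 * n) short ⟩
  6 * n + 2 * n         ≡⟨ e₃ n ⟩
  2 * (4 * n)           ∎))
  where
  open ≤-Reasoning
  e₁ : ∀ t → suc (2 * (3 * t)) + 5 ≡ 6 * suc t
  e₁ = solve-∀
  e₂ : ∀ n j → 6 * (n + j) ≡ 6 * n + 3 * (2 * j)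
  e₂ = solve-∀
  e₃ : ∀ n → 6 * n + 2 * n ≡ 2 * (4 * n)
  e₃ = solve-∀

module _ {n : ℕ} {G : Graph n} where

  tourFromLongCycle : Connected G → ∀ {v} (C : Walk G v v) → Unique (inner C) → 2 * n ≤ 3 * len C →
                      Σ (Walk G v v) λ t → TSPTour G t × 3 * len t ≤ 4 * n
  tourFromLongCycle connected C !C long with t , tour , bound ← tourByDetours connected C =
    t , tour , detour-arith {len t} {n = n} bound onCycle long
    where
    onCycle : len C ≤ count (visited C)
    onCycle = begin
      len C                  ≡⟨ length-inner C ⟨
      length (inner C)       ≤⟨ length≤count-∈ᵇ !C ⟩
      count (_∈ᵇ inner C)    ≤⟨ count-mono (∈ᵇ-mono {xs = inner C} (inner⊆verts C)) ⟩
      count (visited C)      ∎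
      where open ≤-Reasoning

  cycleJoin : (T : Graph n) → Parity → ∀ {v} → Walk G v v → List (SomeWalk G)
  cycleJoin T g C = classEdges (parity ∘ deg T) g 0ℙ C

  -- Either class of edges of C is a T-join for the odd-degree vertices of T other than v.
  cycleJoin-eulerian : (T : Graph n) → SpanningTree G T → ∀ {v} (C : Walk G v v) → Unique (inner C) →
                       (∀ x → OddDegree T x → x ∈ inner C) → ∀ g → Eulerian T v (λ _ → true) (cycleJoin T g C)
  cycleJoin-eulerian T (_ , connectedT , _) {v} C !C oddOnC g = record
    { root∈S  = refl
    ; reaches = λ x _ → connectedT x v , All.tabulate (λ _ → refl)
    ; ends∈S  = All.tabulate (λ _ → refl , refl)
    ; even    = even
    }
    where
    J = cycleJoin T g C
    parity-degree-J : ∀ {x} → x ≢ v → parity (degree J x) ≡ parity (deg T x)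
    parity-degree-J {x} x≢v with x ∈? inner C
    ... | yes x∈C = parity-degree-classEdges (parity ∘ deg T) g 0ℙ C !C x∈C x≢v x≢v
    ... | no  x∉C with parity (deg T x) in odd
    ...   | 0ℙ = cong parity (degree-classEdges-∉ (parity ∘ deg T) g 0ℙ C (∉verts C x∉C x≢v))
    ...   | 1ℙ = contradiction (oddOnC x (parity≡1ℙ⇒%2≡1 (deg T x) odd)) x∉C
    even : EvenOffRoot T v (λ _ → true) J
    even x _ x≢v = begin
      parity (count (adj T x) + degree J x)            ≡⟨ +-homo-+ (count (adj T x)) (degree J x) ⟩
      parity (count (adj T x)) ℙ.+ parity (degree J x)
        ≡⟨ cong₂ ℙ._+_ (cong parity (sym (deg≡count T x))) (parity-degree-J x≢v) ⟩
      parity (deg T x) ℙ.+ parity (deg T x)            ≡⟨ p+p≡0ℙ (parity (deg T x)) ⟩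
      0ℙ                                               ∎
      where open ≡-Reasoning

  tourFromShortCycle : (T : Graph n) → SpanningTree G T → ∀ {v} (C : Walk G v v) → Unique (inner C) →
                       (∀ x → OddDegree T x → x ∈ inner C) → 3 * len C < 2 * n →
                       Σ (Walk G v v) λ t → TSPTour G t × 3 * len t ≤ 4 * n
  tourFromShortCycle T tree@(T⊆G , _ , acyclic) {v} C !C oddOnC short
    with g , light ← lighterClass (parity ∘ deg T) C
    with t , cover , bound ← eulerTour T v T⊆G acyclic (cycleJoin-eulerian T tree C !C oddOnC g) =
    t , (λ x → cover x (inj₁ refl)) ,
    euler-arith {n = n} (subst (λ k → suc (len t) ≤ k + totalLen (cycleJoin T g C)) (count-true n) bound) light short

theorem1 : (n : ℕ) (G : Graph n) → TwoVertexConnected G →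
    (T : Graph n) → SpanningTree G T →
    (v : Fin n) (C : Walk G v v) → SimpleCycle G C →
    (∀ x → OddDegree T x → x ∈ inner C) →
    ∃ λ s → Σ (Walk G s s) (λ t → TSPTour G t × 3 * len t ≤ 4 * n)
theorem1 n G (_ , connected , _) T tree v C (_ , !C) oddOnC with 2 * n ≤? 3 * len C
... | yes long = v , tourFromLongCycle connected C !C long
... | no  short = v , tourFromShortCycle T tree C !C oddOnC (≰⇒> short)
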